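{- (Posetal adjoint functor theorem for frames.) Let $X$ and $Y$ be locales (large, locally small and small-complete over the base universe $\mathcal{U}$), and let $h : \mathcal{O}(Y) \to \mathcal{O}(X)$ be a monotone map. Assume that there exists (unspecified, i.e. propositionally truncated) a small weak base for $Y$. Then $h$ has a right adjoint if and only if $h$ preserves joins of all small families, i.e. $h(\bigvee_{i:I} U_i) = \bigvee_{i:I} h(U_i)$ for every family $(U_i)_{i:I}$ with $I : \mathcal{U}$.
   Context: Setting: univalent type theory (Martin-Löf type theory with universes, function and propositional extensionality, propositional truncations). $\Omega_{\mathcal{U}}$ is the type of propositions in universe $\mathcal{U}$. "There exists" means the propositional truncation of a $\Sigma$-type (unspecified existence); "specified" means an untruncated $\Sigma$. Fix a base universe $\mathcal{U}$; a type is small if it is equivalent to a type in $\mathcal{U}$, and a family $(x_i)_{i:I}$ is small if $I:\mathcal{U}$. A frame $L$ consists of a type $|L|$ in the successor universe $\mathcal{U}^+$, a partial order valued in $\Omega_{\mathcal{U}}$, a top element, binary meets, and joins of all small families, such that binary meets distribute over small joins. A locale $X$ is a frame $\mathcal{O}(X)$ regarded in the opposite category. A family $(U_i)_{i:I}$ is directed if $I$ is inhabited and for all $i,j$ there exists $k$ with $U_i, U_j \le U_k$. A small weak base for a locale $Y$ is a family $B : I \to \mathcal{O}(Y)$ with $I:\mathcal{U}$ such that for every open $U$ there exists (unspecified) a type $J:\mathcal{U}$ and a map $\alpha : J \to I$ with $(B_{\alpha(j)})_{j:J}$ directed and $U = \bigvee_{j:J} B_{\alpha(j)}$. A monotone $g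 : \mathcal{O}(X) \to \mathcal{O}(Y)$ is a right adjoint of $h$ if $h(V) \le U \iff V \le g(U)$ for all $V, U$. -}

module Defs where

open import Level using (Level; _⊔_; Setω) renaming (suc to lsuc)
open import Relation.Binary.PropositionalEquality using (_≡_)
open import Data.Product using (Σ; Σ-syntax; _×_)

isProp : ∀ {a} → Set a → Set a
isProp A = (x y : A) → x ≡ y

FunExt : Setω
FunExt = ∀ {a b} {A : Set a} {B : A → Set b} {f g : (x : A) → B x}
         → ((x : A) → f x ≡ g x) → f ≡ g

PropExt : Setω
PropExt = ∀ {a} {P Q : Set a} → isProp P → isProp Q → (P → Q) → (Q → P) → P ≡ Q

record PropTrunc : Setω where
  field
    ∥_∥       : ∀ {a} → Set a → Set a
    ∥∥-isProp : ∀ {a} {A : Set a} → isProp ∥ A ∥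
    ∣_∣       : ∀ {a} {A : Set a} → A → ∥ A ∥
    ∥∥-rec    : ∀ {a b} {A : Set a} {P : Set b} → isProp P → (A → P) → ∥ A ∥ → P

record Frame (𝓊 : Level) : Set (lsuc (lsuc 𝓊)) where
  infix 4 _≤_
  infixr 7 _∧_
  field
    ∣_∣      : Set (lsuc 𝓊)
    _≤_      : ∣_∣ → ∣_∣ → Set 𝓊
    ≤-prop   : (x y : ∣_∣) → isProp (x ≤ y)
    ≤-refl   : (x : ∣_∣) → x ≤ x
    ≤-trans  : {x y z : ∣_∣} → x ≤ y → y ≤ z → x ≤ z
    ≤-antisym : {x y : ∣_∣} → x ≤ y → y ≤ x → x ≡ y
    ⊤        : ∣_∣
    ⊤-max    : (x : ∣_∣) → x ≤ ⊤
    _∧_      : ∣_∣ → ∣_∣ → ∣_∣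
    ∧-lower₁ : (x y : ∣_∣) → x ∧ y ≤ x
    ∧-lower₂ : (x y : ∣_∣) → x ∧ y ≤ y
    ∧-greatest : {x y z : ∣_∣} → z ≤ x → z ≤ y → z ≤ x ∧ y
    ⋁        : (I : Set 𝓊) → (I → ∣_∣) → ∣_∣
    ⋁-upper  : (I : Set 𝓊) (U : I → ∣_∣) (i : I) → U i ≤ ⋁ I U
    ⋁-least  : (I : Set 𝓊) (U : I → ∣_∣) (z : ∣_∣) → ((i : I) → U i ≤ z) → ⋁ I U ≤ z
    distrib  : (x : ∣_∣) (I : Set 𝓊) (U : I → ∣_∣) → x ∧ ⋁ I U ≡ ⋁ I (λ i → x ∧ U i)

record Locale (𝓊 : Level) : Set (lsuc (lsuc 𝓊)) where
  field
    𝒪 : Frame 𝓊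

open Locale public

⟨_⟩ : ∀ {𝓊} → Locale 𝓊 → Set (lsuc 𝓊)
⟨ X ⟩ = Frame.∣_∣ (𝒪 X)

module _ {𝓊 : Level} where

  IsMonotone : (X Y : Locale 𝓊) → (⟨ X ⟩ → ⟨ Y ⟩) → Set (lsuc 𝓊)
  IsMonotone X Y f = (U V : ⟨ X ⟩) → Frame._≤_ (𝒪 X) U V → Frame._≤_ (𝒪 Y) (f U) (f V)

  HasRightAdjoint : (X Y : Locale 𝓊) → (⟨ Y ⟩ → ⟨ X ⟩) → Set (lsuc 𝓊)
  HasRightAdjoint X Y h =
    Σ[ g ∈ (⟨ X ⟩ → ⟨ Y ⟩) ]
      (IsMonotone X Y g
       × ((V : ⟨ Y ⟩) (U : ⟨ X ⟩) →
            (Frame._≤_ (𝒪 X) (h V) U → Frame._≤_ (𝒪 Y) V (g U))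
          × (Frame._≤_ (𝒪 Y) V (g U) → Frame._≤_ (𝒪 X) (h V) U)))

  PreservesSmallJoins : (Y X : Locale 𝓊) → (⟨ Y ⟩ → ⟨ X ⟩) → Set (lsuc 𝓊)
  PreservesSmallJoins Y X h =
    (I : Set 𝓊) (U : I → ⟨ Y ⟩) → h (Frame.⋁ (𝒪 Y) I U) ≡ Frame.⋁ (𝒪 X) I (λ i → h (U i))

module WithPT (pt : PropTrunc) where
  open PropTrunc pt

  module _ {𝓊 : Level} where

    IsDirected : (Y : Locale 𝓊) {J : Set 𝓊} → (J → ⟨ Y ⟩) → Set 𝓊
    IsDirected Y {J} U =
      ∥ J ∥ × ((i j : J) → ∥ Σ[ k ∈ J ] (Frame._≤_ (𝒪 Y) (U i) (U k) × Frame._≤_ (𝒪 Y) (U j) (U k)) ∥)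

    SmallWeakBase : Locale 𝓊 → Set (lsuc 𝓊)
    SmallWeakBase Y =
      Σ[ I ∈ Set 𝓊 ] Σ[ B ∈ (I → ⟨ Y ⟩) ]
        ((U : ⟨ Y ⟩) → ∥ Σ[ J ∈ Set 𝓊 ] Σ[ α ∈ (J → I) ]
                           (IsDirected Y (λ j → B (α j)) × (U ≡ Frame.⋁ (𝒪 Y) J (λ j → B (α j)))) ∥)

{-# OPTIONS --safe #-}
-- A left adjoint preserves every join that exists, so one direction is formal.
-- Conversely, if h preserves small joins and B : I → 𝒪 Y is a small weak base,
-- set  g U = ⋁ { B i ∣ h (B i) ≤ U }.  This is a small join, h (g U) ≤ U because
-- h preserves it, and V ≤ g (h V) because V is the join of the basic opens below
-- it.  Since right adjoints are unique, HasRightAdjoint is a proposition, so the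
-- construction may use a base that only exists in the truncated sense.
module Submission where

open import Defs
open import Level using (Level)
open import Function using (_∘_)
open import Data.Product using (Σ; Σ-syntax; _×_; _,_; proj₁; proj₂)
open import Data.Product.Properties using (Σ-≡,≡→≡; ×-≡,≡→≡)
open import Relation.Binary.PropositionalEquality using (_≡_; subst; sym)

isProp-× : ∀ {a b} {A : Set a} {B : Set b} → isProp A → isProp B → isProp (A × B)
isProp-× A-prop B-prop (a , b) (a′ , b′) = ×-≡,≡→≡ (A-prop a a′ , B-prop b b′)

isProp-Π : FunExt → ∀ {a b} {A : Set a} {B : A → Set b}
         → ((x : A) → isProp (B x)) → isProp ((x : A) → B x)
isProp-Π fe B-prop f g = fe (λ x → B-prop x (f x) (g x))

module _ {𝓊 : Level} (F : Frame 𝓊) where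
  open Frame F

  ⋁-restrict : {I : Set 𝓊} → (I → ∣_∣) → (I → Set 𝓊) → ∣_∣
  ⋁-restrict {I} B P = ⋁ (Σ I P) (B ∘ proj₁)

  ⋁-restrict-upper : {I : Set 𝓊} (B : I → ∣_∣) (P : I → Set 𝓊) {i : I}
                   → P i → B i ≤ ⋁-restrict B P
  ⋁-restrict-upper {I} B P {i} p = ⋁-upper (Σ I P) (B ∘ proj₁) (i , p)

  ⋁-restrict-mono : {I : Set 𝓊} (B : I → ∣_∣) {P Q : I → Set 𝓊}
                  → (∀ i → P i → Q i) → ⋁-restrict B P ≤ ⋁-restrict B Q
  ⋁-restrict-mono B {Q = Q} P⊆Q =
    ⋁-least _ _ _ (λ (i , p) → ⋁-restrict-upper B Q (P⊆Q i p))

module _ {𝓊 : Level} (X Y : Locale 𝓊) where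
  private
    module X = Frame (𝒪 X)
    module Y = Frame (𝒪 Y)

  leftAdjoint⇒preserves-⋁ : (h : ⟨ Y ⟩ → ⟨ X ⟩) → IsMonotone Y X h
                          → HasRightAdjoint X Y h → PreservesSmallJoins Y X h
  leftAdjoint⇒preserves-⋁ h h-mono (_ , _ , adj) I U = X.≤-antisym
    (proj₂ (adj (Y.⋁ I U) _) (Y.⋁-least I U _ λ i →
      proj₁ (adj (U i) _) (X.⋁-upper I (h ∘ U) i)))
    (X.⋁-least I (h ∘ U) _ λ i → h-mono _ _ (Y.⋁-upper I U i))

  HasRightAdjoint-isProp : FunExt → (h : ⟨ Y ⟩ → ⟨ X ⟩) → isProp (HasRightAdjoint X Y h)
  HasRightAdjoint-isProp fe h (g , _ , adj) (g′ , _ , adj′) =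
    Σ-≡,≡→≡ (g≡g′ , adjunction-isProp g′ _ _)
    where
    g≡g′ : g ≡ g′
    g≡g′ = fe λ U → Y.≤-antisym
      (proj₁ (adj′ (g U) U) (proj₂ (adj (g U) U) (Y.≤-refl _)))
      (proj₁ (adj (g′ U) U) (proj₂ (adj′ (g′ U) U) (Y.≤-refl _)))

    adjunction-isProp : (f : ⟨ X ⟩ → ⟨ Y ⟩)
      → isProp (IsMonotone X Y f
                × ((V : ⟨ Y ⟩) (U : ⟨ X ⟩) →
                     (h V X.≤ U → V Y.≤ f U) × (V Y.≤ f U → h V X.≤ U)))
    adjunction-isProp f = isProp-×
      (isProp-Π fe λ _ → isProp-Π fe λ _ → isProp-Π fe λ _ → Y.≤-prop _ _)
      (isProp-Π fe λ _ → isProp-Π fe λ _ → isProp-×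
        (isProp-Π fe λ _ → Y.≤-prop _ _) (isProp-Π fe λ _ → X.≤-prop _ _))

  unit+counit⇒HasRightAdjoint : (h : ⟨ Y ⟩ → ⟨ X ⟩) (g : ⟨ X ⟩ → ⟨ Y ⟩)
    → IsMonotone Y X h → IsMonotone X Y g
    → ((V : ⟨ Y ⟩) → V Y.≤ g (h V)) → ((U : ⟨ X ⟩) → h (g U) X.≤ U)
    → HasRightAdjoint X Y h
  unit+counit⇒HasRightAdjoint h g h-mono g-mono unit counit =
    g , g-mono , λ V U →
      (λ hV≤U → Y.≤-trans (unit V) (g-mono _ _ hV≤U)) ,
      (λ V≤gU → X.≤-trans (h-mono _ _ V≤gU) (counit U))

module _ (pt : PropTrunc) where
  open PropTrunc pt
  open WithPT pt

  module _ {𝓊 : Level} (Y : Locale 𝓊) where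
    private
      module Y = Frame (𝒪 Y)

    ≤-⋁-basic-below : ((_ , B , _) : SmallWeakBase Y) (V : ⟨ Y ⟩)
                    → V Y.≤ ⋁-restrict (𝒪 Y) B (λ i → B i Y.≤ V)
    ≤-⋁-basic-below (I , B , cover) V = ∥∥-rec (Y.≤-prop _ _) from-cover (cover V)
      where
      basic-below : ⟨ Y ⟩
      basic-below = ⋁-restrict (𝒪 Y) B (λ i → B i Y.≤ V)

      from-cover : Σ[ J ∈ Set 𝓊 ] Σ[ α ∈ (J → I) ]
                     (IsDirected Y (B ∘ α) × (V ≡ Y.⋁ J (B ∘ α)))
                 → V Y.≤ basic-below
      from-cover (J , α , _ , V≡⋁Bα) =
        subst (Y._≤ basic-below) (sym V≡⋁Bα) (Y.⋁-least J (B ∘ α) basic-below λ j →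
          ⋁-restrict-upper (𝒪 Y) B (λ i → B i Y.≤ V)
            (subst (B (α j) Y.≤_) (sym V≡⋁Bα) (Y.⋁-upper J (B ∘ α) j)))

  module _ {𝓊 : Level} (X Y : Locale 𝓊) (h : ⟨ Y ⟩ → ⟨ X ⟩)
           (h-mono : IsMonotone Y X h) (h-⋁ : PreservesSmallJoins Y X h) where
    private
      module X = Frame (𝒪 X)
      module Y = Frame (𝒪 Y)

    weakBase⇒HasRightAdjoint : SmallWeakBase Y → HasRightAdjoint X Y h
    weakBase⇒HasRightAdjoint base@(_ , B , _) =
      unit+counit⇒HasRightAdjoint X Y h g h-mono g-mono unit counit
      where
      g : ⟨ X ⟩ → ⟨ Y ⟩
      g U = ⋁-restrict (𝒪 Y) B (λ i → h (B i) X.≤ U)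

      g-mono : IsMonotone X Y g
      g-mono U U′ U≤U′ = ⋁-restrict-mono (𝒪 Y) B λ _ hBi≤U → X.≤-trans hBi≤U U≤U′

      unit : (V : ⟨ Y ⟩) → V Y.≤ g (h V)
      unit V = Y.≤-trans (≤-⋁-basic-below Y base V)
        (⋁-restrict-mono (𝒪 Y) B λ _ → h-mono _ _)

      counit : (U : ⟨ X ⟩) → h (g U) X.≤ U
      counit U = subst (X._≤ U) (sym (h-⋁ _ _)) (X.⋁-least _ _ U proj₂)

mainTheorem1 : (fe : FunExt) (pe : PropExt) (pt : PropTrunc)
               {𝓊 : Level} (X Y : Locale 𝓊) (h : ⟨ Y ⟩ → ⟨ X ⟩)
               → IsMonotone Y X h
               → PropTrunc.∥_∥ pt (WithPT.SmallWeakBase pt Y)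
               → (HasRightAdjoint X Y h → PreservesSmallJoins Y X h)
                 × (PreservesSmallJoins Y X h → HasRightAdjoint X Y h)
mainTheorem1 fe _ pt X Y h h-mono ∥base∥ =
  leftAdjoint⇒preserves-⋁ X Y h h-mono ,
  λ h-⋁ → PropTrunc.∥∥-rec pt (HasRightAdjoint-isProp X Y fe h)
            (weakBase⇒HasRightAdjoint pt X Y h h-mono h-⋁) ∥base∥
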